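{- For $\gamma=\left(\begin{smallmatrix} a&b\\ Nc&d\end{smallmatrix}\right)\in\Gamma_0(N)$, define $\mathrm{height}(\gamma)=\max\{|a|,|b|,|c|,|d|\}$. Let $\tau_1,\ldots,\tau_\ell\in\bigl\{T,T^{ -1},W,W^{ -1}\bigr\}$, with $\tau_{i+1}\ne\tau_i^{ -1}$ for every $i=1,\ldots,\ell-1$. Then, provided that $N\ge4$, $$ \mathrm{height}(\tau_1\cdots\tau_\ell)\ge \max\{\mathrm{height}(\tau_1\cdots\tau_{\ell-1}), \mathrm{height}(\tau_2\cdots\tau_\ell)\}. $$
   Context: $T=\left(\begin{smallmatrix} 1&1\\0&1\end{smallmatrix}\right)$ and $W=\left(\begin{smallmatrix} 1&0\\ N&1\end{smallmatrix}\right)$, with $N\in\mathbb{N}$. -}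

module Defs where

open import Data.Nat as ℕ using (ℕ; _⊔_; _/_; NonZero)
open import Data.Integer as ℤ using (ℤ; +_; -_; ∣_∣)
open import Data.List using (List; []; _∷_; foldr)
open import Data.Product using (_×_)
open import Data.Unit using (⊤)
open import Relation.Binary.PropositionalEquality using (_≢_)

record M₂ : Set where
  constructor mat
  field
    a b c' d : ℤ
open M₂ public

_·_ : M₂ → M₂ → M₂
mat a₁ b₁ c₁ d₁ · mat a₂ b₂ c₂ d₂ =
  mat (a₁ ℤ.* a₂ ℤ.+ b₁ ℤ.* c₂) (a₁ ℤ.* b₂ ℤ.+ b₁ ℤ.* d₂)
      (c₁ ℤ.* a₂ ℤ.+ d₁ ℤ.* c₂) (c₁ ℤ.* b₂ ℤ.+ d₁ ℤ.* d₂)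

I₂ : M₂
I₂ = mat (+ 1) (+ 0) (+ 0) (+ 1)

data Gen : Set where
  T T⁻¹ W W⁻¹ : Gen

inv : Gen → Gen
inv T = T⁻¹
inv T⁻¹ = T
inv W = W⁻¹
inv W⁻¹ = W

⟦_⟧ : Gen → ℕ → M₂
⟦ T ⟧ N = mat (+ 1) (+ 1) (+ 0) (+ 1)
⟦ T⁻¹ ⟧ N = mat (+ 1) (- + 1) (+ 0) (+ 1)
⟦ W ⟧ N = mat (+ 1) (+ 0) (+ N) (+ 1)
⟦ W⁻¹ ⟧ N = mat (+ 1) (+ 0) (- + N) (+ 1)

prod : ℕ → List Gen → M₂
prod N = foldr (λ g m → ⟦ g ⟧ N · m) I₂

-- height of γ = (a b ; Nc d) ∈ Γ₀(N): max{|a|,|b|,|c|,|d|} with c = (lower-left)/N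
height : (N : ℕ) → .{{NonZero N}} → M₂ → ℕ
height N γ = ∣ a γ ∣ ⊔ ∣ b γ ∣ ⊔ (∣ c' γ ∣ / N) ⊔ ∣ d γ ∣

Reduced : List Gen → Set
Reduced [] = ⊤
Reduced (x ∷ []) = ⊤
Reduced (x ∷ y ∷ xs) = (y ≢ inv x) × Reduced (y ∷ xs)

module Submission where

-- Write a generator's effect on a row vector (x y) of a matrix:
-- right multiplication by T, T⁻¹, W, W⁻¹ sends (x , y) to (x , y ± x) resp.
-- (x ± N y , y).  Left multiplication acts in the same way on the columns,
-- read from bottom to top.  To each generator g we attach a cone of pairs:
-- for T the pairs ±(p , q) with p ≤ 2q or q = 0, for W the pairs ±(p , q)
-- with 2q ≤ p or p = 0 (p , q ≥ 0), and for T⁻¹, W⁻¹ the mirror images under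
-- (x , y) ↦ (x , - y).  The key "ping-pong" lemma 'step' says: if v lies in
-- the cone of g and h ≠ g⁻¹, then h·v lies in the cone of h and no entry of
-- v decreases in absolute value.  Thanks to the two sign symmetries it only
-- has to be checked on the nonnegative quadrant for g ∈ {T, W}, where the
-- two interesting moves (W⁻¹ after T, T⁻¹ after W) need N ≥ 4.
-- Since both rows of I₂ lie in every cone, induction along a reduced word
-- shows that appending a letter on the right (acting on rows) or prepending
-- one on the left (acting on columns) never decreases any entry, hence
-- never decreases the height; this gives the two halves of lemma4p14.

open import Defs
open import Data.Nat using (ℕ; _≤_; _⊔_; _∸_; NonZero)
open import Data.List using (List; []; length; take; drop)
open import Relation.Binary.PropositionalEquality using (_≢_)

open import Data.Nat as ℕ using (z≤n)
import Data.Nat.Properties as ℕP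
open import Data.Nat.DivMod using (/-monoˡ-≤)
import Data.Nat.Tactic.RingSolver as ℕSolver
open import Data.Integer as ℤ using (ℤ; +_; -_; ∣_∣)
import Data.Integer.Properties as ℤP
open import Data.Integer.Tactic.RingSolver using (solve-∀)
open import Data.List using (_∷_)
open import Data.Product using (_×_; _,_; proj₁; proj₂; swap)
open import Data.Sum using (_⊎_; inj₁; inj₂)
open import Data.Empty using (⊥-elim)
open import Relation.Binary.PropositionalEquality
  using (_≡_; refl; sym; trans; cong; cong₂; subst; subst₂)

inv-involutive : ∀ g → inv (inv g) ≡ g
inv-involutive T = refl
inv-involutive T⁻¹ = refl
inv-involutive W = refl
inv-involutive W⁻¹ = refl

inv-irreflexive : ∀ g → g ≢ inv g
inv-irreflexive T ()
inv-irreflexive T⁻¹ ()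
inv-irreflexive W ()
inv-irreflexive W⁻¹ ()

≢-inv-sym : ∀ {g h} → h ≢ inv g → g ≢ inv h
≢-inv-sym {g} {h} h≢g⁻¹ g≡h⁻¹ =
  h≢g⁻¹ (sym (trans (cong inv g≡h⁻¹) (inv-involutive h)))

-- Conjugation by diag(1, -1) exchanges each generator with its inverse.
mirror : Gen → Gen
mirror T = T⁻¹
mirror T⁻¹ = T
mirror W = W⁻¹
mirror W⁻¹ = W

mirror-involutive : ∀ g → mirror (mirror g) ≡ g
mirror-involutive T = refl
mirror-involutive T⁻¹ = refl
mirror-involutive W = refl
mirror-involutive W⁻¹ = refl

mirror-≢ : ∀ {g h} → h ≢ g → mirror h ≢ mirror g
mirror-≢ {g} {h} h≢g eq =
  h≢g (trans (sym (mirror-involutive h)) (trans (cong mirror eq) (mirror-involutive g)))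

neg flipY : ℤ × ℤ → ℤ × ℤ
neg (x , y) = - x , - y
flipY (x , y) = x , - y

flipY-involutive : ∀ v → flipY (flipY v) ≡ v
flipY-involutive (x , y) = cong (x ,_) (ℤP.neg-involutive y)

_≼_ : ℤ × ℤ → ℤ × ℤ → Set
(x , y) ≼ (x' , y') = ∣ x ∣ ≤ ∣ x' ∣ × ∣ y ∣ ≤ ∣ y' ∣

≼-neg : ∀ u w → u ≼ w → neg u ≼ neg w
≼-neg (x , y) (x' , y') (x≤ , y≤) =
  subst₂ _≤_ (sym (ℤP.∣-i∣≡∣i∣ x)) (sym (ℤP.∣-i∣≡∣i∣ x')) x≤ ,
  subst₂ _≤_ (sym (ℤP.∣-i∣≡∣i∣ y)) (sym (ℤP.∣-i∣≡∣i∣ y')) y≤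

≼-flipY : ∀ u w → flipY u ≼ w → u ≼ flipY w
≼-flipY (x , y) (x' , y') (x≤ , y≤) =
  x≤ , subst₂ _≤_ (ℤP.∣-i∣≡∣i∣ y) (sym (ℤP.∣-i∣≡∣i∣ y')) y≤

act : ℕ → Gen → ℤ × ℤ → ℤ × ℤ
act N T (x , y) = x , y ℤ.+ x
act N T⁻¹ (x , y) = x , y ℤ.- x
act N W (x , y) = x ℤ.+ + N ℤ.* y , y
act N W⁻¹ (x , y) = x ℤ.- + N ℤ.* y , y

act-neg : ∀ N h u → act N h (neg u) ≡ neg (act N h u)
act-neg N T (x , y) = cong (- x ,_) (lemma x y)
  where lemma : ∀ x y → - y ℤ.+ - x ≡ - (y ℤ.+ x)
        lemma = solve-∀
act-neg N T⁻¹ (x , y) = cong (- x ,_) (lemma x y)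
  where lemma : ∀ x y → - y ℤ.- - x ≡ - (y ℤ.- x)
        lemma = solve-∀
act-neg N W (x , y) = cong (_, - y) (lemma x y (+ N))
  where lemma : ∀ x y n → - x ℤ.+ n ℤ.* - y ≡ - (x ℤ.+ n ℤ.* y)
        lemma = solve-∀
act-neg N W⁻¹ (x , y) = cong (_, - y) (lemma x y (+ N))
  where lemma : ∀ x y n → - x ℤ.- n ℤ.* - y ≡ - (x ℤ.- n ℤ.* y)
        lemma = solve-∀

act-mirror : ∀ N h v → act N h v ≡ flipY (act N (mirror h) (flipY v))
act-mirror N T (x , y) = cong (x ,_) (lemma x y)
  where lemma : ∀ x y → y ℤ.+ x ≡ - (- y ℤ.- x)
        lemma = solve-∀
act-mirror N T⁻¹ (x , y) = cong (x ,_) (lemma x y)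
  where lemma : ∀ x y → y ℤ.- x ≡ - (- y ℤ.+ x)
        lemma = solve-∀
act-mirror N W (x , y) = cong₂ _,_ (lemma x y (+ N)) (sym (ℤP.neg-involutive y))
  where lemma : ∀ x y n → x ℤ.+ n ℤ.* y ≡ x ℤ.- n ℤ.* - y
        lemma = solve-∀
act-mirror N W⁻¹ (x , y) = cong₂ _,_ (lemma x y (+ N)) (sym (ℤP.neg-involutive y))
  where lemma : ∀ x y n → x ℤ.- n ℤ.* y ≡ x ℤ.+ n ℤ.* - y
        lemma = solve-∀

TCone WCone : ℕ → ℕ → Set
TCone p q = p ≤ q ℕ.+ q ⊎ q ≡ 0
WCone p q = q ℕ.+ q ≤ p ⊎ p ≡ 0

data ± (P : ℕ → ℕ → Set) : ℤ × ℤ → Set where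
  plus : ∀ {p q} → P p q → ± P (+ p , + q)
  minus : ∀ {p q} → P p q → ± P (- + p , - + q)

±-neg : ∀ {P v} → ± P v → ± P (neg v)
±-neg (plus c) = minus c
±-neg (minus {p} {q} c) =
  subst (± _) (sym (cong₂ _,_ (ℤP.neg-involutive (+ p)) (ℤP.neg-involutive (+ q)))) (plus c)

-- Cone g v : a row of a product of a reduced word ending in g lies in Cone g.
Cone : Gen → ℤ × ℤ → Set
Cone T v = ± TCone v
Cone T⁻¹ v = ± TCone (flipY v)
Cone W v = ± WCone v
Cone W⁻¹ v = ± WCone (flipY v)

cone-neg : ∀ h {w} → Cone h w → Cone h (neg w)
cone-neg T c = ±-neg c
cone-neg T⁻¹ c = ±-neg c
cone-neg W c = ±-neg c
cone-neg W⁻¹ c = ±-neg c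

cone-mirror : ∀ h {w} → Cone (mirror h) w → Cone h (flipY w)
cone-mirror T c = c
cone-mirror T⁻¹ {w} c = subst (± TCone) (sym (flipY-involutive w)) c
cone-mirror W c = c
cone-mirror W⁻¹ {w} c = subst (± WCone) (sym (flipY-involutive w)) c

unit-cones : ∀ g → Cone g (+ 1 , + 0) × Cone g (+ 0 , + 1)
unit-cones T = plus (inj₂ refl) , plus (inj₁ z≤n)
unit-cones T⁻¹ = plus (inj₂ refl) , minus (inj₁ z≤n)
unit-cones W = plus (inj₁ z≤n) , plus (inj₂ refl)
unit-cones W⁻¹ = plus (inj₁ z≤n) , minus (inj₂ refl)

Lands : Gen → ℤ × ℤ → ℤ × ℤ → Set
Lands h v w = Cone h w × v ≼ w

sub-≤ : ∀ {m n} → m ≤ n → + m ℤ.- + n ≡ - + (n ∸ m)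
sub-≤ {m} {n} m≤n = trans (ℤP.m-n≡m⊖n m n) (ℤP.⊖-≤ m≤n)

forward-T : ∀ N p q → Lands T (+ p , + q) (act N T (+ p , + q))
forward-T N p q =
  plus (inj₁ (ℕP.≤-trans (ℕP.m≤n+m p q) (ℕP.m≤m+n (q ℕ.+ p) (q ℕ.+ p)))) ,
  ℕP.≤-refl , ℕP.m≤m+n q p

module _ {N : ℕ} (4≤N : 4 ≤ N) where

  4q≤Nq : ∀ q → (q ℕ.+ q) ℕ.+ (q ℕ.+ q) ≤ N ℕ.* q
  4q≤Nq q = subst (_≤ N ℕ.* q) (four q) (ℕP.*-monoˡ-≤ q 4≤N)
    where four : ∀ q → 4 ℕ.* q ≡ (q ℕ.+ q) ℕ.+ (q ℕ.+ q)
          four = ℕSolver.solve-∀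

  forward-W : ∀ p q → Lands W (+ p , + q) (act N W (+ p , + q))
  forward-W p q = subst (Lands W (+ p , + q)) (sym value) (landing , ℕP.m≤m+n p (N ℕ.* q) , ℕP.≤-refl)
    where
    value : act N W (+ p , + q) ≡ (+ (p ℕ.+ N ℕ.* q) , + q)
    value = cong (λ z → (+ p ℤ.+ z , + q)) (sym (ℤP.pos-* N q))
    landing : Cone W (+ (p ℕ.+ N ℕ.* q) , + q)
    landing = plus (inj₁ (ℕP.m≤n⇒m≤o+n p (ℕP.≤-trans (ℕP.m≤m+n (q ℕ.+ q) (q ℕ.+ q)) (4q≤Nq q))))

  T-then-W⁻¹ : ∀ {p q} → TCone p q → Lands W⁻¹ (+ p , + q) (act N W⁻¹ (+ p , + q))
  T-then-W⁻¹ {p} (inj₂ refl) = subst (Lands W⁻¹ (+ p , + 0)) (sym value) (plus (inj₁ z≤n) , ℕP.≤-refl , z≤n)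
    where
    value : act N W⁻¹ (+ p , + 0) ≡ (+ p , + 0)
    value = cong (_, + 0) (trans (cong (λ z → + p ℤ.- z) (ℤP.*-zeroʳ (+ N))) (ℤP.+-identityʳ (+ p)))
  T-then-W⁻¹ {p} {q} (inj₁ p≤2q) =
    subst (Lands W⁻¹ (+ p , + q)) (sym value)
      (minus (inj₁ (ℕP.m+n≤o⇒m≤o∸n (q ℕ.+ q) 2q+p≤Nq)) , p≤∣Nq-p∣ , ℕP.≤-refl)
    where
    2q+p≤Nq : (q ℕ.+ q) ℕ.+ p ≤ N ℕ.* q
    2q+p≤Nq = ℕP.≤-trans (ℕP.+-monoʳ-≤ (q ℕ.+ q) p≤2q) (4q≤Nq q)
    p+p≤Nq : p ℕ.+ p ≤ N ℕ.* q
    p+p≤Nq = ℕP.≤-trans (ℕP.+-mono-≤ p≤2q p≤2q) (4q≤Nq q)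
    p≤Nq : p ≤ N ℕ.* q
    p≤Nq = ℕP.≤-trans (ℕP.m≤m+n p p) p+p≤Nq
    value : act N W⁻¹ (+ p , + q) ≡ (- + (N ℕ.* q ∸ p) , + q)
    value = cong (_, + q) (trans (cong (λ z → + p ℤ.- z) (sym (ℤP.pos-* N q))) (sub-≤ p≤Nq))
    p≤∣Nq-p∣ : p ≤ ∣ - + (N ℕ.* q ∸ p) ∣
    p≤∣Nq-p∣ = subst (p ≤_) (sym (ℤP.∣-i∣≡∣i∣ (+ (N ℕ.* q ∸ p)))) (ℕP.m+n≤o⇒m≤o∸n p p+p≤Nq)

  W-then-T⁻¹ : ∀ {p q} → WCone p q → Lands T⁻¹ (+ p , + q) (act N T⁻¹ (+ p , + q))
  W-then-T⁻¹ {q = q} (inj₂ refl) = subst (Lands T⁻¹ (+ 0 , + q)) (sym value) (minus (inj₁ z≤n) , z≤n , ℕP.≤-refl)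
    where
    value : act N T⁻¹ (+ 0 , + q) ≡ (+ 0 , + q)
    value = cong (+ 0 ,_) (ℤP.+-identityʳ (+ q))
  W-then-T⁻¹ {p} {q} (inj₁ 2q≤p) =
    subst (Lands T⁻¹ (+ p , + q)) (sym value)
      (subst (λ y → ± TCone (+ p , y)) (sym (ℤP.neg-involutive (+ (p ∸ q)))) (plus (inj₁ p≤2[p-q])) , ℕP.≤-refl , q≤∣q-p∣)
    where
    q≤p-q : q ≤ p ∸ q
    q≤p-q = ℕP.m+n≤o⇒m≤o∸n q 2q≤p
    p≤2[p-q] : p ≤ (p ∸ q) ℕ.+ (p ∸ q)
    p≤2[p-q] = ℕP.≤-trans (ℕP.m≤n+m∸n p q) (ℕP.+-monoˡ-≤ (p ∸ q) q≤p-q)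
    value : act N T⁻¹ (+ p , + q) ≡ (+ p , - + (p ∸ q))
    value = cong (+ p ,_) (sub-≤ (ℕP.≤-trans (ℕP.m≤m+n q q) 2q≤p))
    q≤∣q-p∣ : q ≤ ∣ - + (p ∸ q) ∣
    q≤∣q-p∣ = subst (q ≤_) (sym (ℤP.∣-i∣≡∣i∣ (+ (p ∸ q)))) q≤p-q

  from-T⁺ : ∀ {p q} → TCone p q → ∀ h → h ≢ T⁻¹ → Lands h (+ p , + q) (act N h (+ p , + q))
  from-T⁺ {p} {q} c T _ = forward-T N p q
  from-T⁺ c T⁻¹ h≢T⁻¹ = ⊥-elim (h≢T⁻¹ refl)
  from-T⁺ {p} {q} c W _ = forward-W p q
  from-T⁺ c W⁻¹ _ = T-then-W⁻¹ c

  from-W⁺ : ∀ {p q} → WCone p q → ∀ h → h ≢ W⁻¹ → Lands h (+ p , + q) (act N h (+ p , + q))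
  from-W⁺ {p} {q} c T _ = forward-T N p q
  from-W⁺ c T⁻¹ _ = W-then-T⁻¹ c
  from-W⁺ {p} {q} c W _ = forward-W p q
  from-W⁺ c W⁻¹ h≢W⁻¹ = ⊥-elim (h≢W⁻¹ refl)

  lands-neg : ∀ h u → Lands h u (act N h u) → Lands h (neg u) (act N h (neg u))
  lands-neg h u (c , u≼) = subst (Lands h (neg u)) (sym (act-neg N h u)) (cone-neg h c , ≼-neg u (act N h u) u≼)

  from-T : ∀ {v} → ± TCone v → ∀ h → h ≢ T⁻¹ → Lands h v (act N h v)
  from-T (plus c) h ne = from-T⁺ c h ne
  from-T (minus c) h ne = lands-neg h _ (from-T⁺ c h ne)

  from-W : ∀ {v} → ± WCone v → ∀ h → h ≢ W⁻¹ → Lands h v (act N h v)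
  from-W (plus c) h ne = from-W⁺ c h ne
  from-W (minus c) h ne = lands-neg h _ (from-W⁺ c h ne)

  lands-mirror : ∀ h v → Lands (mirror h) (flipY v) (act N (mirror h) (flipY v)) → Lands h v (act N h v)
  lands-mirror h v (c , v≼) = subst (Lands h v) (sym (act-mirror N h v)) (cone-mirror h c , ≼-flipY v (act N (mirror h) (flipY v)) v≼)

  step : ∀ g h {v} → Cone g v → h ≢ inv g → Lands h v (act N h v)
  step T h c ne = from-T c h ne
  step W h c ne = from-W c h ne
  step T⁻¹ h {v} c ne = lands-mirror h v (from-T c (mirror h) (mirror-≢ ne))
  step W⁻¹ h {v} c ne = lands-mirror h v (from-W c (mirror h) (mirror-≢ ne))

top bottom left right : M₂ → ℤ × ℤ
top M = a M , b M
bottom M = c' M , d M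
left M = c' M , a M
right M = d M , b M

-- Row vector times matrix: the rows of M · G are  top M ⊙ G  and  bottom M ⊙ G.
_⊙_ : ℤ × ℤ → M₂ → ℤ × ℤ
(x , y) ⊙ G = x ℤ.* a G ℤ.+ y ℤ.* c' G , x ℤ.* b G ℤ.+ y ℤ.* d G

-- Matrix times a column read from bottom to top: the columns of G · M are
-- G ⊛ left M  and  G ⊛ right M.
_⊛_ : M₂ → ℤ × ℤ → ℤ × ℤ
G ⊛ (x , y) = c' G ℤ.* y ℤ.+ d G ℤ.* x , a G ℤ.* y ℤ.+ b G ℤ.* x

⊛≡⊙ : ∀ G v → a G ≡ d G → G ⊛ v ≡ v ⊙ G
⊛≡⊙ (mat α β γ δ) (x , y) refl = cong₂ _,_ (lemma γ α y x) (lemma α β y x)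
  where lemma : ∀ γ α y x → γ ℤ.* y ℤ.+ α ℤ.* x ≡ x ℤ.* α ℤ.+ y ℤ.* γ
        lemma = solve-∀

first-coordinate : ∀ x y → x ℤ.* + 1 ℤ.+ y ℤ.* + 0 ≡ x
first-coordinate = solve-∀

second-coordinate : ∀ x y → x ℤ.* + 0 ℤ.+ y ℤ.* + 1 ≡ y
second-coordinate = solve-∀

⊙-identity : ∀ v → v ⊙ I₂ ≡ v
⊙-identity (x , y) = cong₂ _,_ (first-coordinate x y) (second-coordinate x y)

⊙-assoc : ∀ v B C → (v ⊙ B) ⊙ C ≡ v ⊙ (B · C)
⊙-assoc (x , y) (mat α β γ δ) (mat α' β' γ' δ') =
  cong₂ _,_ (lemma x y α β γ δ α' γ') (lemma x y α β γ δ β' δ')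
  where lemma : ∀ x y α β γ δ α' γ' →
                (x ℤ.* α ℤ.+ y ℤ.* γ) ℤ.* α' ℤ.+ (x ℤ.* β ℤ.+ y ℤ.* δ) ℤ.* γ'
                  ≡ x ℤ.* (α ℤ.* α' ℤ.+ β ℤ.* γ') ℤ.+ y ℤ.* (γ ℤ.* α' ℤ.+ δ ℤ.* γ')
        lemma = solve-∀

rows-≡ : ∀ {M M'} → top M ≡ top M' → bottom M ≡ bottom M' → M ≡ M'
rows-≡ refl refl = refl

cols-≡ : ∀ {M M'} → left M ≡ left M' → right M ≡ right M' → M ≡ M'
cols-≡ refl refl = refl

·-identityˡ : ∀ M → I₂ · M ≡ M
·-identityˡ M = cols-≡ (trans (⊛≡⊙ I₂ (left M) refl) (⊙-identity (left M)))
                       (trans (⊛≡⊙ I₂ (right M) refl) (⊙-identity (right M)))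

·-identityʳ : ∀ M → M · I₂ ≡ M
·-identityʳ M = rows-≡ (⊙-identity (top M)) (⊙-identity (bottom M))

·-assoc : ∀ A B C → (A · B) · C ≡ A · (B · C)
·-assoc A B C = rows-≡ (⊙-assoc (top A) B C) (⊙-assoc (bottom A) B C)

row-act : ∀ N g v → v ⊙ ⟦ g ⟧ N ≡ act N g v
row-act N T (x , y) = cong₂ _,_ (first-coordinate x y) (lemma x y)
  where lemma : ∀ x y → x ℤ.* + 1 ℤ.+ y ℤ.* + 1 ≡ y ℤ.+ x
        lemma = solve-∀
row-act N T⁻¹ (x , y) = cong₂ _,_ (first-coordinate x y) (lemma x y)
  where lemma : ∀ x y → x ℤ.* - + 1 ℤ.+ y ℤ.* + 1 ≡ y ℤ.- x
        lemma = solve-∀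
row-act N W (x , y) = cong₂ _,_ (lemma x y (+ N)) (second-coordinate x y)
  where lemma : ∀ x y n → x ℤ.* + 1 ℤ.+ y ℤ.* n ≡ x ℤ.+ n ℤ.* y
        lemma = solve-∀
row-act N W⁻¹ (x , y) = cong₂ _,_ (lemma x y (+ N)) (second-coordinate x y)
  where lemma : ∀ x y n → x ℤ.* + 1 ℤ.+ y ℤ.* - n ≡ x ℤ.- n ℤ.* y
        lemma = solve-∀

col-act : ∀ N g v → ⟦ g ⟧ N ⊛ v ≡ act N g v
col-act N g v = trans (⊛≡⊙ (⟦ g ⟧ N) v (diagonal g)) (row-act N g v)
  where diagonal : ∀ g → a (⟦ g ⟧ N) ≡ d (⟦ g ⟧ N)
        diagonal T = refl
        diagonal T⁻¹ = refl
        diagonal W = refl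
        diagonal W⁻¹ = refl

height-mono : ∀ N .{{_ : NonZero N}} M M' →
  ∣ a M ∣ ≤ ∣ a M' ∣ → ∣ b M ∣ ≤ ∣ b M' ∣ → ∣ c' M ∣ ≤ ∣ c' M' ∣ → ∣ d M ∣ ≤ ∣ d M' ∣ →
  height N M ≤ height N M'
height-mono N M M' a≤ b≤ c≤ d≤ = ℕP.⊔-mono-≤ (ℕP.⊔-mono-≤ (ℕP.⊔-mono-≤ a≤ b≤) (/-monoˡ-≤ N c≤)) d≤

module _ {N : ℕ} .{{_ : NonZero N}} (4≤N : 4 ≤ N) where

  RowsIn ColsIn : Gen → M₂ → Set
  RowsIn g M = Cone g (top M) × Cone g (bottom M)
  ColsIn g M = Cone g (left M) × Cone g (right M)

  right-step : ∀ g h M → RowsIn g M → h ≢ inv g →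
    RowsIn h (M · ⟦ h ⟧ N) × height N M ≤ height N (M · ⟦ h ⟧ N)
  right-step g h M (top∈ , bottom∈) h≢g⁻¹ =
    let (top∈' , a≤ , b≤) = moved (top M) top∈
        (bottom∈' , c≤ , d≤) = moved (bottom M) bottom∈
    in (top∈' , bottom∈') , height-mono N M (M · ⟦ h ⟧ N) a≤ b≤ c≤ d≤
    where moved : ∀ v → Cone g v → Lands h v (v ⊙ ⟦ h ⟧ N)
          moved v v∈ = subst (Lands h v) (sym (row-act N h v)) (step 4≤N g h v∈ h≢g⁻¹)

  left-step : ∀ g h M → ColsIn g M → h ≢ inv g →
    ColsIn h (⟦ h ⟧ N · M) × height N M ≤ height N (⟦ h ⟧ N · M)
  left-step g h M (left∈ , right∈) h≢g⁻¹ =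
    let (left∈' , c≤ , a≤) = moved (left M) left∈
        (right∈' , d≤ , b≤) = moved (right M) right∈
    in (left∈' , right∈') , height-mono N M (⟦ h ⟧ N · M) a≤ b≤ c≤ d≤
    where moved : ∀ v → Cone g v → Lands h v (⟦ h ⟧ N ⊛ v)
          moved v v∈ = subst (Lands h v) (sym (col-act N h v)) (step 4≤N g h v∈ h≢g⁻¹)

  prefix-grows : ∀ g w M → RowsIn g M → Reduced (g ∷ w) → w ≢ [] →
    height N (M · prod N (take (length w ∸ 1) w)) ≤ height N (M · prod N w)
  prefix-grows g [] M _ _ w≢[] = ⊥-elim (w≢[] refl)
  prefix-grows g (h ∷ []) M rows∈ (h≢g⁻¹ , _) _ =
    subst₂ (λ A B → height N A ≤ height N B)
      (sym (·-identityʳ M)) (sym (cong (M ·_) (·-identityʳ (⟦ h ⟧ N))))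
      (proj₂ (right-step g h M rows∈ h≢g⁻¹))
  prefix-grows g (h ∷ h' ∷ w) M rows∈ (h≢g⁻¹ , reduced) _ =
    subst₂ (λ A B → height N A ≤ height N B) (·-assoc M (⟦ h ⟧ N) _) (·-assoc M (⟦ h ⟧ N) _)
      (prefix-grows h (h' ∷ w) (M · ⟦ h ⟧ N) (proj₁ (right-step g h M rows∈ h≢g⁻¹)) reduced (λ ()))

  suffix-grows : ∀ g τ → Reduced (g ∷ τ) →
    ColsIn g (prod N (g ∷ τ)) × height N (prod N τ) ≤ height N (prod N (g ∷ τ))
  suffix-grows g [] _ = left-step g g I₂ (swap (unit-cones g)) (inv-irreflexive g)
  suffix-grows g (h ∷ τ) (h≢g⁻¹ , reduced) =
    left-step h g (prod N (h ∷ τ)) (proj₁ (suffix-grows h τ reduced)) (≢-inv-sym h≢g⁻¹)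

lemma4p14 : (N : ℕ) → .{{_ : NonZero N}} → 4 ≤ N →
    (τ : List Gen) → τ ≢ [] → Reduced τ →
    height N (prod N (take (length τ ∸ 1) τ)) ⊔ height N (prod N (drop 1 τ))
      ≤ height N (prod N τ)
lemma4p14 N 4≤N [] τ≢[] _ = ⊥-elim (τ≢[] refl)
lemma4p14 N 4≤N (g ∷ τ) gτ≢[] reduced = ℕP.⊔-lub last-deleted first-deleted
  where
  -- Start from I₂, whose rows lie in every cone; pretend the previous letter was g.
  last-deleted : height N (prod N (take (length τ) (g ∷ τ))) ≤ height N (prod N (g ∷ τ))
  last-deleted =
    subst₂ (λ A B → height N A ≤ height N B) (·-identityˡ (prod N (take (length τ) (g ∷ τ)))) (·-identityˡ (prod N (g ∷ τ)))
      (prefix-grows 4≤N g (g ∷ τ) I₂ (unit-cones g) (inv-irreflexive g , reduced) gτ≢[])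
  first-deleted : height N (prod N τ) ≤ height N (prod N (g ∷ τ))
  first-deleted = proj₂ (suffix-grows 4≤N g τ reduced)
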